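{- Let $G=(V,E)$ be a finite connected graph whose vertices are coloured using only two colours. Then among all shortest sequences of moves that make $G$ monochromatic, there is one in which every move is played at the same vertex $v \in V$, i.e. there is a vertex $v$ such that some shortest flooding sequence consists only of moves of the form $(v,d)$.
   Context: Free-Flood-It on a graph: given a graph $G$ with a vertex colouring $\omega$ from a colour-set $C$, a move $(v,d)$ with $v \in V$, $d \in C$ gives colour $d$ to every vertex of the monochromatic connected component containing $v$ (in the current colouring). A sequence of moves floods $G$ (makes it monochromatic) if afterwards all vertices have the same colour. With two colours, a move at $v$ simply switches the colour of the monochromatic component containing $v$ to the other colour. -}

module Defs where

open import Data.Nat using (ℕ; suc)
open import Data.Fin using (Fin)
open import Data.Bool using (Bool)
open import Data.List using (List; []; _∷_)
open import Data.Product using (Σ; _×_)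
open import Relation.Nullary using (¬_; Dec)
open import Relation.Binary.PropositionalEquality using (_≡_)
open import Relation.Binary.Construct.Closure.ReflexiveTransitive using (Star)

record Graph (n : ℕ) : Set₁ where
  field
    Adj     : Fin n → Fin n → Set
    adj?    : ∀ u v → Dec (Adj u v)
    sym     : ∀ {u v} → Adj u v → Adj v u
    irrefl  : ∀ {u} → ¬ Adj u u
open Graph public

Connected : ∀ {n} → Graph n → Set
Connected {n} G = ∀ (u w : Fin n) → Star (Adj G) u w

Colouring : ℕ → Set
Colouring n = Fin n → Bool

MonoAdj : ∀ {n} → Graph n → Colouring n → Fin n → Fin n → Set
MonoAdj G ω u w = Adj G u w × ω u ≡ ω w

SameComp : ∀ {n} → Graph n → Colouring n → Fin n → Fin n → Set
SameComp G ω u w = Star (MonoAdj G ω) u w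

Move : ℕ → Set
Move n = Fin n × Bool

data Step {n} (G : Graph n) (ω : Colouring n) : Move n → Colouring n → Set where
  step : ∀ {v d ω'} →
         (∀ u → SameComp G ω v u → ω' u ≡ d) →
         (∀ u → ¬ SameComp G ω v u → ω' u ≡ ω u) →
         Step G ω (v Data.Product., d) ω'

data Run {n} (G : Graph n) : Colouring n → List (Move n) → Colouring n → Set where
  done : ∀ {ω} → Run G ω [] ω
  more : ∀ {ω ω' ω'' m ms} → Step G ω m ω' → Run G ω' ms ω'' → Run G ω (m ∷ ms) ω''

Monochromatic : ∀ {n} → Colouring n → Set
Monochromatic {n} ω = ∀ (u w : Fin n) → ω u ≡ ω w

Floods : ∀ {n} → Graph n → Colouring n → List (Move n) → Set
Floods {n} G ω ms = Σ (Colouring n) λ ω' → Run G ω ms ω' × Monochromatic ω'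

-- With two colours every component adjacent to the monochromatic component of
-- v has the other colour, so a move at v that switches its colour merges it with
-- all of them.  Hence, in the graph obtained by contracting the monochromatic
-- components, each move at v lowers the eccentricity of v by one, and playing
-- at a centre floods G in radius-many moves.  Conversely, a move anywhere lowers
-- the radius of the contracted graph by at most one, so no flooding sequence is
-- shorter.
module Submission where

open import Defs
open import Data.Nat using (ℕ; zero; suc; pred; _≤_; _<_; _+_; _⊔_; s≤s)
open import Data.Nat.Properties
  using (≤-refl; ≤-trans; ≤-reflexive; ≮⇒≥; n≤1+n; m≤m+n; m≤n+m; m≤m⊔n; m≤n⊔m; pred-mono-≤;
         +-monoˡ-≤; +-suc; anyUpTo?; module ≤-Reasoning)
open import Data.Nat.Induction using (<-rec)
open import Data.Fin using (Fin; zero; suc; punchIn; punchOut)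
open import Data.Fin.Properties using (punchIn-punchOut; punchInᵢ≢i; any?; all?) renaming (_≟_ to _≟ᶠ_)
open import Data.Bool using (Bool; not) renaming (_≟_ to _≟ᵇ_)
open import Data.Bool.Properties using (¬-not)
open import Data.List using (List; []; _∷_; map; length)
open import Data.Product using (Σ; ∃; _×_; _,_; proj₁)
open import Data.Sum as Sum using (_⊎_; inj₁; inj₂; [_,_])
open import Function using (id)
open import Relation.Nullary using (¬_; Dec; yes; no; contradiction)
open import Relation.Nullary.Decidable using (map′; _×-dec_; _⊎-dec_)
open import Relation.Binary.PropositionalEquality as ≡ using (_≡_; _≢_; refl; cong; subst; subst₂)
open import Relation.Binary.Construct.Closure.ReflexiveTransitive using (Star; ε; _◅_; _◅◅_; gmap; reverse)

Least : (ℕ → Set) → Set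
Least P = Σ ℕ λ t → P t × (∀ j → P j → t ≤ j)

least : {P : ℕ → Set} → (∀ j → Dec (P j)) → ∀ {N} → P N → Least P
least {P} P? {N} = <-rec (λ N → P N → Least P) search N
  where
  search : ∀ N → (∀ {j} → j < N → P j → Least P) → P N → Least P
  search N below pN with anyUpTo? P? N
  ... | yes (j , j<N , pj) = below j<N pj
  ... | no none = N , pN , λ j pj → ≮⇒≥ (λ j<N → none (j , j<N , pj))

uniform-bound : ∀ m (Q : Fin m → ℕ → Set) → (∀ u {k k′} → k ≤ k′ → Q u k → Q u k′) →
                (∀ u → ∃ (Q u)) → ∃ λ K → ∀ u → Q u K
uniform-bound zero Q Q-mono bounded = 0 , λ ()
uniform-bound (suc m) Q Q-mono bounded
  with bounded zero | uniform-bound m (λ u → Q (suc u)) (λ u → Q-mono (suc u)) (λ u → bounded (suc u))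
... | k , q | K , qs = k ⊔ K , λ { zero → Q-mono zero (m≤m⊔n k K) q
                                ; (suc u) → Q-mono (suc u) (m≤n⊔m k K) (qs u) }

-- A walk from a to b ≠ a may be taken to leave a once and never come back,
-- so after its first edge it lives on the m remaining vertices.
Star-dec : ∀ m {R : Fin m → Fin m → Set} → (∀ a b → Dec (R a b)) → ∀ a b → Dec (Star R a b)
Star-dec zero R? ()
Star-dec (suc m) {R} R? a b with a ≟ᶠ b
... | yes refl = yes ε
... | no a≢b = map′ fromLeavesOnce toLeavesOnce
      (any? λ x → R? a (punchIn a x) ×-dec Star-dec m (λ i j → R? (punchIn a i) (punchIn a j)) x b′)
  where
  R′ : Fin m → Fin m → Set
  R′ i j = R (punchIn a i) (punchIn a j)
  b′ : Fin m
  b′ = punchOut a≢b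
  LeavesOnce : Set
  LeavesOnce = Σ (Fin m) λ x → R a (punchIn a x) × Star R′ x b′
  fromLeavesOnce : LeavesOnce → Star R a b
  fromLeavesOnce (x , r , rest) = r ◅ subst (Star R _) (punchIn-punchOut a≢b) (gmap (punchIn a) id rest)
  split-at-a : ∀ {y} → Star R y b → LeavesOnce ⊎ (Σ (Fin m) λ y′ → punchIn a y′ ≡ y × Star R′ y′ b′)
  split-at-a ε = inj₂ (b′ , punchIn-punchOut a≢b , ε)
  split-at-a {y} (r ◅ rest) with split-at-a rest
  ... | inj₁ once = inj₁ once
  ... | inj₂ (z′ , z≡ , rest′) with a ≟ᶠ y
  ...   | yes refl = inj₁ (z′ , subst (R a) (≡.sym z≡) r , rest′)
  ...   | no a≢y = inj₂ (punchOut a≢y , punchIn-punchOut a≢y ,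
                        subst₂ R (≡.sym (punchIn-punchOut a≢y)) (≡.sym z≡) r ◅ rest′)
  toLeavesOnce : Star R a b → LeavesOnce
  toLeavesOnce s with split-at-a s
  ... | inj₁ once = once
  ... | inj₂ (y′ , y≡a , _) = contradiction y≡a (punchInᵢ≢i a y′)

module Flooding {n : ℕ} (G : Graph n) where

  V : Set
  V = Fin n

  module _ {ω : Colouring n} where

    MonoAdj-sym : ∀ {a b} → MonoAdj G ω a b → MonoAdj G ω b a
    MonoAdj-sym (adj , e) = sym G adj , ≡.sym e

    SameComp-sym : ∀ {a b} → SameComp G ω a b → SameComp G ω b a
    SameComp-sym = reverse MonoAdj-sym

    SameComp-colour : ∀ {a b} → SameComp G ω a b → ω a ≡ ω b
    SameComp-colour ε = refl
    SameComp-colour ((_ , e) ◅ rest) = ≡.trans e (SameComp-colour rest)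

  SameComp-dec : ∀ ω a b → Dec (SameComp G ω a b)
  SameComp-dec ω = Star-dec n λ a b → adj? G a b ×-dec (ω a ≟ᵇ ω b)

  -- Within ω k a b: a walk from a to b using at most k edges that are not
  -- monochromatic edges, i.e. distance at most k after contracting every
  -- monochromatic component of ω.
  data Within (ω : Colouring n) : ℕ → V → V → Set where
    here : ∀ {k a} → Within ω k a a
    same : ∀ {k a x b} → MonoAdj G ω a x → Within ω k x b → Within ω k a b
    hop  : ∀ {k a x b} → Adj G a x → Within ω k x b → Within ω (suc k) a b

  Ecc≤ : Colouring n → ℕ → V → Set
  Ecc≤ ω k v = ∀ u → Within ω k v u

  Radius≤ : Colouring n → ℕ → Set
  Radius≤ ω k = Σ V (Ecc≤ ω k)

  Hop : Colouring n → V → V → Set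
  Hop ω a y = Σ V λ x → SameComp G ω a x × (x ≡ y ⊎ Adj G x y)

  module _ {ω : Colouring n} where

    Within-mono : ∀ {k k′ a b} → k ≤ k′ → Within ω k a b → Within ω k′ a b
    Within-mono k≤k′ here = here
    Within-mono k≤k′ (same e w) = same e (Within-mono k≤k′ w)
    Within-mono (s≤s k≤k′) (hop adj w) = hop adj (Within-mono k≤k′ w)

    Within-trans : ∀ {i j a b c} → Within ω i a b → Within ω j b c → Within ω (i + j) a c
    Within-trans {i} {j} here w′ = Within-mono (m≤n+m j i) w′
    Within-trans (same e w) w′ = same e (Within-trans w w′)
    Within-trans (hop adj w) w′ = hop adj (Within-trans w w′)

    SameComp⇒Within : ∀ {k a b} → SameComp G ω a b → Within ω k a b
    SameComp⇒Within ε = here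
    SameComp⇒Within (e ◅ rest) = same e (SameComp⇒Within rest)

    Within-zero⇒SameComp : ∀ {a b} → Within ω 0 a b → SameComp G ω a b
    Within-zero⇒SameComp here = ε
    Within-zero⇒SameComp (same e w) = e ◅ Within-zero⇒SameComp w

    Star⇒Within : ∀ {a b} → Star (Adj G) a b → ∃ λ k → Within ω k a b
    Star⇒Within ε = 0 , here
    Star⇒Within (adj ◅ rest) = let k , w = Star⇒Within rest in suc k , hop adj w

    Within-suc⁻ : ∀ {k a b} → Within ω (suc k) a b → Σ V λ y → Hop ω a y × Within ω k y b
    Within-suc⁻ {a = a} here = a , (a , ε , inj₁ refl) , here
    Within-suc⁻ (same e w) = let y , (x , s , xy) , w′ = Within-suc⁻ w in y , (x , e ◅ s , xy) , w′
    Within-suc⁻ {a = a} (hop {x = x} adj w) = x , (a , ε , inj₂ adj) , w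

    Within-suc⁺ : ∀ {k a b} → Σ V (λ y → Hop ω a y × Within ω k y b) → Within ω (suc k) a b
    Within-suc⁺ (y , (x , s , inj₁ refl) , w) =
      Within-trans (SameComp⇒Within {k = 0} s) (Within-mono (n≤1+n _) w)
    Within-suc⁺ (y , (x , s , inj₂ adj) , w) = Within-trans (SameComp⇒Within {k = 0} s) (hop adj w)

    Hop⇒Within-reversed : ∀ {a y} → Hop ω a y → Within ω 1 y a
    Hop⇒Within-reversed (x , s , inj₁ refl) = SameComp⇒Within (SameComp-sym s)
    Hop⇒Within-reversed (x , s , inj₂ adj) = hop (sym G adj) (SameComp⇒Within (SameComp-sym s))

    Within-advance : ∀ {t a b} → Within ω t a b → Σ V λ y → Within ω 1 y a × Within ω (pred t) y b
    Within-advance {zero} {b = b} w = b , SameComp⇒Within (SameComp-sym (Within-zero⇒SameComp w)) , here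
    Within-advance {suc t} w = let y , h , w′ = Within-suc⁻ w in y , Hop⇒Within-reversed h , w′

  Within-map : ∀ {ω ω′} → (∀ {a b} → MonoAdj G ω a b → MonoAdj G ω′ a b) →
               ∀ {k a b} → Within ω k a b → Within ω′ k a b
  Within-map f here = here
  Within-map f (same e w) = same (f e) (Within-map f w)
  Within-map f (hop adj w) = hop adj (Within-map f w)

  Within-dec : ∀ ω k a b → Dec (Within ω k a b)
  Within-dec ω zero a b = map′ SameComp⇒Within Within-zero⇒SameComp (SameComp-dec ω a b)
  Within-dec ω (suc k) a b = map′ Within-suc⁺ Within-suc⁻
    (any? λ y → any? (λ x → SameComp-dec ω a x ×-dec ((x ≟ᶠ y) ⊎-dec adj? G x y))
                ×-dec Within-dec ω k y b)

  Radius≤-dec : ∀ ω k → Dec (Radius≤ ω k)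
  Radius≤-dec ω k = any? λ v → all? λ u → Within-dec ω k v u

  Step-inside : ∀ {ω ω′ w d} → Step G ω (w , d) ω′ → ∀ u → SameComp G ω w u → ω′ u ≡ d
  Step-inside (step inside _) = inside

  Step-outside : ∀ {ω ω′ w d} → Step G ω (w , d) ω′ → ∀ u → ¬ SameComp G ω w u → ω′ u ≡ ω u
  Step-outside (step _ outside) = outside

  module AfterMove {ω ω′ : Colouring n} {w : V} {d : Bool} (move : Step G ω (w , d) ω′) where

    Flooded : V → Set
    Flooded = SameComp G ω w

    flooded? : ∀ a → Dec (Flooded a)
    flooded? = SameComp-dec ω w

    Flooded-step : ∀ {a x} → Flooded a → MonoAdj G ω a x → Flooded x
    Flooded-step fa e = fa ◅◅ (e ◅ ε)

    Flooded⇒Within : ∀ {k a} → Flooded a → Within ω k a w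
    Flooded⇒Within fa = SameComp⇒Within (SameComp-sym fa)

    colour-inside : ∀ {a} → Flooded a → ω′ a ≡ d
    colour-inside = Step-inside move _

    colour-outside : ∀ {a} → ¬ Flooded a → ω′ a ≡ ω a
    colour-outside = Step-outside move _

    MonoAdj-preserved : ∀ {a x} → MonoAdj G ω a x → MonoAdj G ω′ a x
    MonoAdj-preserved {a} {x} e@(adj , ωa≡ωx) with flooded? a
    ... | yes fa = adj , ≡.trans (colour-inside fa) (≡.sym (colour-inside (Flooded-step fa e)))
    ... | no na = adj , ≡.trans (colour-outside na) (≡.trans ωa≡ωx (≡.sym (colour-outside nx)))
      where
      nx : ¬ Flooded x
      nx fx = na (Flooded-step fx (MonoAdj-sym e))

    MonoAdj-reflected : ∀ {a x} → ¬ Flooded a → ¬ Flooded x → MonoAdj G ω′ a x → MonoAdj G ω a x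
    MonoAdj-reflected na nx (adj , e) =
      adj , ≡.trans (≡.sym (colour-outside na)) (≡.trans e (colour-outside nx))

    neighbour-colour : d ≡ not (ω w) → ∀ {a x} → Flooded a → Adj G a x → ω′ x ≡ d
    neighbour-colour d≡ {a} {x} fa adj with flooded? x
    ... | yes fx = colour-inside fx
    ... | no nx = ≡.trans (colour-outside nx) (≡.trans (¬-not ωx≢ωw) (≡.sym d≡))
      where
      ωx≢ωw : ω x ≢ ω w
      ωx≢ωw e = nx (Flooded-step fa (adj , ≡.trans (≡.sym (SameComp-colour fa)) (≡.sym e)))

    Within-shrink : d ≡ not (ω w) → ∀ {j a u} → Flooded a → Within ω (suc j) a u → Within ω′ j a u
    Within-shrink d≡ fa here = here
    Within-shrink d≡ fa (same e r) = same (MonoAdj-preserved e) (Within-shrink d≡ (Flooded-step fa e) r)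
    Within-shrink d≡ fa (hop adj r) =
      same (adj , ≡.trans (colour-inside fa) (≡.sym (neighbour-colour d≡ fa adj)))
           (Within-map MonoAdj-preserved r)

    -- Cutting an ω′-walk at its last visit to the flooded component.
    Within-after-move : ∀ {s a u} → Within ω′ s a u →
                        Within ω (suc s) w u ⊎ (¬ Flooded a × Within ω s a u)
    Within-after-move {a = a} here with flooded? a
    ... | yes fa = inj₁ (SameComp⇒Within fa)
    ... | no na = inj₂ (na , here)
    Within-after-move {a = a} (same e r) with Within-after-move r
    ... | inj₁ r′ = inj₁ r′
    ... | inj₂ (nx , r′) with flooded? a
    ...   | yes fa = inj₁ (Within-trans (SameComp⇒Within {k = 0} fa) (hop (proj₁ e) r′))
    ...   | no na = inj₂ (na , same (MonoAdj-reflected na nx e) r′)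
    Within-after-move {a = a} (hop adj r) with Within-after-move r
    ... | inj₁ r′ = inj₁ (Within-mono (n≤1+n _) r′)
    ... | inj₂ (nx , r′) with flooded? a
    ...   | yes fa =
      inj₁ (Within-trans (SameComp⇒Within {k = 0} fa) (Within-mono (n≤1+n _) (hop adj r′)))
    ...   | no na = inj₂ (na , hop adj r′)

    Within-from-flooded : ∀ {s c u} → Flooded c → Within ω′ s c u → Within ω (suc s) w u
    Within-from-flooded fc r = [ id , (λ out → contradiction fc (proj₁ out)) ] (Within-after-move r)

    ThroughFlooded : ℕ → V → V → Set
    ThroughFlooded m a u = Σ ℕ λ p → Σ ℕ λ s → p + s ≤ m × Within ω (suc p) a w × Within ω (suc s) w u

    -- Cutting an ω′-walk at its first visit to the flooded component.
    Within-split : ∀ {m a u} → Within ω′ m a u → Within ω m a u ⊎ ThroughFlooded m a u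
    Within-split {m} {a} r with flooded? a
    ... | yes fa = inj₂ (0 , m , ≤-refl , Flooded⇒Within fa , Within-from-flooded fa r)
    ... | no na = split-outside na r
      where
      split-outside : ∀ {m a u} → ¬ Flooded a → Within ω′ m a u → Within ω m a u ⊎ ThroughFlooded m a u
      split-outside na here = inj₁ here
      split-outside {m} na (same {x = x} e r) with flooded? x
      ... | yes fx = inj₂ (0 , m , ≤-refl , hop (proj₁ e) (Flooded⇒Within fx) , Within-from-flooded fx r)
      ... | no nx = Sum.map (same e′) (λ (p , s , le , pre , post) → p , s , le , same e′ pre , post)
                      (split-outside nx r)
        where
        e′ = MonoAdj-reflected na nx e
      split-outside na (hop {k = m} {x = x} adj r) with flooded? x
      ... | yes fx = inj₂ (0 , m , n≤1+n m , hop adj (Flooded⇒Within fx) , Within-from-flooded fx r)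
      ... | no nx = Sum.map (hop adj) (λ (p , s , le , pre , post) → suc p , s , s≤s le , hop adj pre , post)
                      (split-outside nx r)

    Within-to-flooded : ∀ {m a} → Within ω′ m a w → Within ω (suc m) a w
    Within-to-flooded r with Within-split r
    ... | inj₁ r′ = Within-mono (n≤1+n _) r′
    ... | inj₂ (p , s , le , pre , _) = Within-mono (s≤s (≤-trans (m≤m+n p s) le)) pre

    -- The new centre is the vertex one step from v′ along a shortest walk to the flooded component.
    Radius≤-before-move : ∀ {k} → Radius≤ ω′ k → Radius≤ ω (suc k)
    Radius≤-before-move {k} (v′ , ecc′)
      with least (λ j → Within-dec ω j v′ w) (Within-to-flooded (ecc′ w))
    ... | t , v′→w , nearest with Within-advance v′→w
    ... | y , y→v′ , y→w = y , λ u → [ Within-trans y→v′ , through-flood ] (Within-split (ecc′ u))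
      where
      through-flood : ∀ {u} → ThroughFlooded k v′ u → Within ω (suc k) y u
      through-flood (p , s , le , pre , post) = Within-mono bound (Within-trans y→w post)
        where
        bound : pred t + suc s ≤ suc k
        bound = begin
          pred t + suc s ≤⟨ +-monoˡ-≤ (suc s) (pred-mono-≤ (nearest (suc p) pre)) ⟩
          p + suc s      ≡⟨ +-suc p s ⟩
          suc (p + s)    ≤⟨ s≤s le ⟩
          suc k          ∎
          where open ≤-Reasoning

  Ecc≤-zero⇒Monochromatic : ∀ {ω v} → Ecc≤ ω 0 v → Monochromatic ω
  Ecc≤-zero⇒Monochromatic ecc u u′ =
    ≡.trans (≡.sym (SameComp-colour (Within-zero⇒SameComp (ecc u))))
            (SameComp-colour (Within-zero⇒SameComp (ecc u′)))

  Monochromatic⇒Ecc≤-zero : Connected G → ∀ {ω} → Monochromatic ω → ∀ v → Ecc≤ ω 0 v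
  Monochromatic⇒Ecc≤-zero conn {ω} monochromatic v u =
    SameComp⇒Within (gmap id (λ {a} {b} adj → adj , monochromatic a b) (conn v u))

  module PlayAt (v : V) where

    flood : Colouring n → Bool → Colouring n
    flood ω d u with SameComp-dec ω v u
    ... | yes _ = d
    ... | no _ = ω u

    flood-step : ∀ ω d → Step G ω (v , d) (flood ω d)
    flood-step ω d = step inside outside
      where
      inside : ∀ u → SameComp G ω v u → flood ω d u ≡ d
      inside u p with SameComp-dec ω v u
      ... | yes _ = refl
      ... | no ¬p = contradiction p ¬p
      outside : ∀ u → ¬ SameComp G ω v u → flood ω d u ≡ ω u
      outside u ¬p with SameComp-dec ω v u
      ... | yes p = contradiction p ¬p
      ... | no _ = refl

    centre-floods : ∀ k ω → Ecc≤ ω k v →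
                    Σ (List Bool) λ ds → length ds ≡ k × Floods G ω (map (λ d → (v , d)) ds)
    centre-floods zero ω ecc = [] , refl , ω , done , Ecc≤-zero⇒Monochromatic ecc
    centre-floods (suc k) ω ecc
      with centre-floods k (flood ω (not (ω v)))
             (λ u → AfterMove.Within-shrink (flood-step ω (not (ω v))) refl ε (ecc u))
    ... | ds , len , ω″ , run , monochromatic =
          not (ω v) ∷ ds , cong suc len , ω″ , more (flood-step ω (not (ω v))) run , monochromatic

  Floods⇒Radius≤ : Connected G → V → ∀ {ω ms ω″} →
                   Run G ω ms ω″ → Monochromatic ω″ → Radius≤ ω (length ms)
  Floods⇒Radius≤ conn v done monochromatic = v , Monochromatic⇒Ecc≤-zero conn monochromatic v
  Floods⇒Radius≤ conn v (more move@(step _ _) run) monochromatic =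
    AfterMove.Radius≤-before-move move (Floods⇒Radius≤ conn v run monochromatic)

  Connected⇒Radius≤ : Connected G → ∀ ω v → ∃ (Radius≤ ω)
  Connected⇒Radius≤ conn ω v =
    let K , ecc = uniform-bound n (λ u k → Within ω k v u) (λ u → Within-mono)
                    (λ u → Star⇒Within (conn v u))
    in K , v , ecc

lemma3p1 : ∀ (n : ℕ) (G : Graph (suc n)) → Connected G → (ω : Colouring (suc n)) →
    Σ (Fin (suc n)) λ v → Σ (List Bool) λ ds →
      Floods G ω (map (λ d → (v , d)) ds) ×
      (∀ (ms : List (Move (suc n))) → Floods G ω ms → length ds ≤ length ms)
lemma3p1 n G conn ω =
  let open Flooding G
      _ , radius≤N = Connected⇒Radius≤ conn ω zero
      t , (v , ecc) , minimal = least (Radius≤-dec ω) radius≤N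
      ds , length≡t , floods = PlayAt.centre-floods v t ω ecc
  in v , ds , floods , λ ms (_ , run , monochromatic) →
       ≤-trans (≤-reflexive length≡t) (minimal (length ms) (Floods⇒Radius≤ conn zero run monochromatic))
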